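{- For each positive integer $m$ there is an isomorphism of oriented graphs between $A(m)$ and $A(2m+1)$.
   Context: A hyperbinary expansion of a positive integer $n$ is a word $x_1\cdots x_k$ over the alphabet $\{0,1,2\}$ with $x_1\neq 0$ and $n=\sum_{i=1}^k x_i2^{k-i}$; $\mathcal H(n)$ denotes the set of hyperbinary expansions of $n$. Words are regarded up to leading zeros. Single-step reductions are: (I) $2\vec y \to 1\,0\,\vec y$; (II) $\vec x\,0\,2\,\vec y\to \vec x\,1\,0\,\vec y$; (III) $\vec x\,1\,2\,\vec y \twoheadrightarrow \vec x\,2\,0\,\vec y$, for words $\vec x,\vec y$ over $\{0,1,2\}$. If $\vec u$ is transformed into $\vec v$ by one single-step reduction, $\vec v$ is a child of $\vec u$. $A(n)$ is the directed graph with vertex set $\mathcal H(n)$ and an arc from $\vec u$ to $\vec v$ iff $\vec v$ is a child of $\vec u$. -}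

module Defs where

open import Data.Nat using (ℕ; zero; suc; _+_; _*_)
open import Data.List using (List; []; _∷_; _++_)
open import Data.Product using (Σ; ∃; _×_; _,_; proj₁)
open import Relation.Binary.PropositionalEquality using (_≡_)
open import Relation.Nullary using (¬_)
open import Function.Definitions using (Bijective)
open import Function.Bundles using (_⇔_)

data Digit : Set where
  d0 d1 d2 : Digit

digitVal : Digit → ℕ
digitVal d0 = 0
digitVal d1 = 1
digitVal d2 = 2

-- words are written most significant digit first: x₁ ⋯ x_k
Word : Set
Word = List Digit

valueAcc : ℕ → Word → ℕ
valueAcc acc []       = acc
valueAcc acc (x ∷ xs) = valueAcc (2 * acc + digitVal x) xs

value : Word → ℕ
value = valueAcc 0

data NoLeadingZero : Word → Set where
  nlz1 : ∀ ys → NoLeadingZero (d1 ∷ ys)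
  nlz2 : ∀ ys → NoLeadingZero (d2 ∷ ys)

Hyp : ℕ → Set
Hyp n = Σ Word (λ w → NoLeadingZero w × value w ≡ n)

-- remove leading zeros (words are regarded up to leading zeros)
stripZeros : Word → Word
stripZeros []        = []
stripZeros (d0 ∷ xs) = stripZeros xs
stripZeros (d1 ∷ xs) = d1 ∷ xs
stripZeros (d2 ∷ xs) = d2 ∷ xs

data Step : Word → Word → Set where
  ruleI   : ∀ y     → Step (d2 ∷ y) (d1 ∷ d0 ∷ y)
  ruleII  : ∀ x y   → Step (x ++ d0 ∷ d2 ∷ y) (x ++ d1 ∷ d0 ∷ y)
  ruleIII : ∀ x y   → Step (x ++ d1 ∷ d2 ∷ y) (x ++ d2 ∷ d0 ∷ y)

Child : Word → Word → Set
Child u v = ∃ λ u′ → ∃ λ v′ →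
  stripZeros u′ ≡ u × stripZeros v′ ≡ v × Step u′ v′

Arc : (n : ℕ) → Hyp n → Hyp n → Set
Arc n u v = Child (proj₁ u) (proj₁ v)

GraphIso : ℕ → ℕ → Set
GraphIso m n = Σ (Hyp m → Hyp n) λ f →
  Bijective _≡_ _≡_ f × (∀ u v → Arc m u v ⇔ Arc n (f u) (f v))

-- Appending the digit 1 is the isomorphism. Every expansion of the odd
-- number 2m+1 ends in 1 and is obtained in this way from exactly one
-- expansion of m. No reduction rule rewrites a last digit 1 (each rule
-- rewrites a factor ending in 2 into one ending in 0), so the children of
-- w1 are exactly the words v1 with v a child of w.
module Submission where

open import Defs
open import Data.Nat using (ℕ; suc; _+_; _*_; _≥_)
open import Data.Nat.Properties
  using (+-comm; +-identityʳ; *-suc; +-cancelʳ-≡; *-cancelˡ-≡; even≢odd; ≡-irrelevant)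
open import Data.List using (List; []; _∷_; _++_; _∷ʳ_; InitLast; initLast; _∷ʳ′_)
open import Data.List.Properties using (++-assoc; ∷ʳ-injective; ∷ʳ-injectiveˡ)
open import Data.Product using (∃; _×_; _,_; proj₁; proj₂)
open import Relation.Binary.PropositionalEquality
  using (_≡_; _≢_; refl; sym; trans; cong; cong₂; module ≡-Reasoning)
open import Relation.Nullary using (contradiction)
open import Function.Bundles using (mk⇔)
open import Function.Consequences.Propositional using (strictlySurjective⇒surjective)

stripZeros-++ : ∀ u {v} → NoLeadingZero v → stripZeros (u ++ v) ≡ stripZeros u ++ v
stripZeros-++ []       (nlz1 _) = refl
stripZeros-++ []       (nlz2 _) = refl
stripZeros-++ (d0 ∷ u) v-nlz    = stripZeros-++ u v-nlz
stripZeros-++ (d1 ∷ u) _        = refl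
stripZeros-++ (d2 ∷ u) _        = refl

stripZeros-∷ʳ⁻¹ : ∀ u′ {w c} → stripZeros u′ ≡ w ∷ʳ c →
                  ∃ λ u → u′ ≡ u ∷ʳ c × stripZeros u ≡ w
stripZeros-∷ʳ⁻¹ []        {[]}    ()
stripZeros-∷ʳ⁻¹ []        {_ ∷ _} ()
stripZeros-∷ʳ⁻¹ (d0 ∷ u′) eq with stripZeros-∷ʳ⁻¹ u′ eq
... | u , refl , strip-u = d0 ∷ u , refl , strip-u
stripZeros-∷ʳ⁻¹ (d1 ∷ u′) {[]}     refl = [] , refl , refl
stripZeros-∷ʳ⁻¹ (d1 ∷ u′) {_ ∷ w} refl = d1 ∷ w , refl , refl
stripZeros-∷ʳ⁻¹ (d2 ∷ u′) {[]}     refl = [] , refl , refl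
stripZeros-∷ʳ⁻¹ (d2 ∷ u′) {_ ∷ w} refl = d2 ∷ w , refl , refl

Step-++ʳ : ∀ {u v} z → Step u v → Step (u ++ z) (v ++ z)
Step-++ʳ z (ruleI y) = ruleI (y ++ z)
Step-++ʳ z (ruleII x y)
  rewrite ++-assoc x (d0 ∷ d2 ∷ y) z | ++-assoc x (d1 ∷ d0 ∷ y) z = ruleII x (y ++ z)
Step-++ʳ z (ruleIII x y)
  rewrite ++-assoc x (d1 ∷ d2 ∷ y) z | ++-assoc x (d2 ∷ d0 ∷ y) z = ruleIII x (y ++ z)

++-∷ʳ-injective : ∀ (s w : Word) {u c c′} → s ++ (w ∷ʳ c′) ≡ u ∷ʳ c → s ++ w ≡ u × c′ ≡ c
++-∷ʳ-injective s w {u} eq = ∷ʳ-injective (s ++ w) u (trans (++-assoc s w _) eq)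

Step-∷ʳ⁻¹ : ∀ {u v} c → Step (u ∷ʳ c) (v ∷ʳ c) → Step u v
Step-∷ʳ⁻¹ c step = peel step refl refl
  where
  d2≢d0 : d2 ≢ d0
  d2≢d0 ()

  peel : ∀ {a b u v} → Step a b → a ≡ u ∷ʳ c → b ≡ v ∷ʳ c → Step u v
  peel {u = []} (ruleI _) refl eb =
    contradiction (sym (proj₂ (++-∷ʳ-injective [] (d1 ∷ []) eb))) d2≢d0
  peel {u = _ ∷ u} (ruleI _) refl eb with refl ← ∷ʳ-injectiveˡ (d1 ∷ d0 ∷ u) _ eb = ruleI u
  peel (ruleII x y) ea eb with initLast y
  ... | [] = contradiction (trans (proj₂ (++-∷ʳ-injective x (d0 ∷ []) ea))
                                  (sym (proj₂ (++-∷ʳ-injective x (d1 ∷ []) eb)))) d2≢d0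
  ... | y′ ∷ʳ′ _ with refl ← proj₁ (++-∷ʳ-injective x (d0 ∷ d2 ∷ y′) ea)
                    | refl ← proj₁ (++-∷ʳ-injective x (d1 ∷ d0 ∷ y′) eb) = ruleII x y′
  peel (ruleIII x y) ea eb with initLast y
  ... | [] = contradiction (trans (proj₂ (++-∷ʳ-injective x (d1 ∷ []) ea))
                                  (sym (proj₂ (++-∷ʳ-injective x (d2 ∷ []) eb)))) d2≢d0
  ... | y′ ∷ʳ′ _ with refl ← proj₁ (++-∷ʳ-injective x (d1 ∷ d2 ∷ y′) ea)
                    | refl ← proj₁ (++-∷ʳ-injective x (d2 ∷ d0 ∷ y′) eb) = ruleIII x y′

Child-∷ʳ-d1 : ∀ {w w′} → Child w w′ → Child (w ∷ʳ d1) (w′ ∷ʳ d1)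
Child-∷ʳ-d1 (u′ , v′ , refl , refl , step) =
  u′ ∷ʳ d1 , v′ ∷ʳ d1 , stripZeros-++ u′ (nlz1 []) , stripZeros-++ v′ (nlz1 [])
    , Step-++ʳ (d1 ∷ []) step

Child-∷ʳ-d1⁻¹ : ∀ {w w′} → Child (w ∷ʳ d1) (w′ ∷ʳ d1) → Child w w′
Child-∷ʳ-d1⁻¹ (u′ , v′ , strip-u′ , strip-v′ , step)
  with u , refl , strip-u ← stripZeros-∷ʳ⁻¹ u′ strip-u′
     | v , refl , strip-v ← stripZeros-∷ʳ⁻¹ v′ strip-v′
  = u , v , strip-u , strip-v , Step-∷ʳ⁻¹ d1 step

valueAcc-++ : ∀ acc xs ys → valueAcc acc (xs ++ ys) ≡ valueAcc (valueAcc acc xs) ys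
valueAcc-++ acc []       ys = refl
valueAcc-++ acc (x ∷ xs) ys = valueAcc-++ (2 * acc + digitVal x) xs ys

value-∷ʳ : ∀ w c → value (w ∷ʳ c) ≡ 2 * value w + digitVal c
value-∷ʳ w c = valueAcc-++ 0 w (c ∷ [])

2*a+c≡2*m+1⇒c≡d1×a≡m : ∀ a m c → 2 * a + digitVal c ≡ 2 * m + 1 → c ≡ d1 × a ≡ m
2*a+c≡2*m+1⇒c≡d1×a≡m a m d0 eq = contradiction (begin
  2 * a      ≡⟨ sym (+-identityʳ (2 * a)) ⟩
  2 * a + 0  ≡⟨ eq ⟩
  2 * m + 1  ≡⟨ +-comm (2 * m) 1 ⟩
  suc (2 * m) ∎) (even≢odd a m)
  where open ≡-Reasoning
2*a+c≡2*m+1⇒c≡d1×a≡m a m d1 eq = refl , *-cancelˡ-≡ a m 2 (+-cancelʳ-≡ 1 (2 * a) (2 * m) eq)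
2*a+c≡2*m+1⇒c≡d1×a≡m a m d2 eq = contradiction (begin
  2 * suc a  ≡⟨ *-suc 2 a ⟩
  2 + 2 * a  ≡⟨ +-comm 2 (2 * a) ⟩
  2 * a + 2  ≡⟨ eq ⟩
  2 * m + 1  ≡⟨ +-comm (2 * m) 1 ⟩
  suc (2 * m) ∎) (even≢odd (suc a) m)
  where open ≡-Reasoning

NoLeadingZero-∷ʳ : ∀ {w} c → NoLeadingZero w → NoLeadingZero (w ∷ʳ c)
NoLeadingZero-∷ʳ c (nlz1 ys) = nlz1 (ys ∷ʳ c)
NoLeadingZero-∷ʳ c (nlz2 ys) = nlz2 (ys ∷ʳ c)

NoLeadingZero-∷ʳ⁻¹ : ∀ {x w c} → NoLeadingZero ((x ∷ w) ∷ʳ c) → NoLeadingZero (x ∷ w)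
NoLeadingZero-∷ʳ⁻¹ (nlz1 _) = nlz1 _
NoLeadingZero-∷ʳ⁻¹ (nlz2 _) = nlz2 _

NoLeadingZero-irrelevant : ∀ {w} (p q : NoLeadingZero w) → p ≡ q
NoLeadingZero-irrelevant (nlz1 _) (nlz1 _) = refl
NoLeadingZero-irrelevant (nlz2 _) (nlz2 _) = refl

Hyp-≡ : ∀ {n} {a b : Hyp n} → proj₁ a ≡ proj₁ b → a ≡ b
Hyp-≡ {a = w , p , e} {b = .w , q , e′} refl =
  cong₂ (λ p e → w , p , e) (NoLeadingZero-irrelevant p q) (≡-irrelevant e e′)

append1 : ∀ {m} → Hyp m → Hyp (2 * m + 1)
append1 (w , w-nlz , w-value) =
  w ∷ʳ d1 , NoLeadingZero-∷ʳ d1 w-nlz , trans (value-∷ʳ w d1) (cong (λ n → 2 * n + 1) w-value)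

append1-injective : ∀ {m} {a b : Hyp m} → append1 a ≡ append1 b → a ≡ b
append1-injective {a = w , _} {b = w′ , _} eq =
  Hyp-≡ (∷ʳ-injectiveˡ w w′ (cong proj₁ eq))

Hyp-odd-split : ∀ {t m} → InitLast t → NoLeadingZero t → value t ≡ 2 * m + 1 → m ≥ 1 →
                ∃ λ (w : Hyp m) → proj₁ w ∷ʳ d1 ≡ t
Hyp-odd-split [] ()
Hyp-odd-split {m = m} (w ∷ʳ′ c) t-nlz t-value m≥1
  with 2*a+c≡2*m+1⇒c≡d1×a≡m (value w) m c (trans (sym (value-∷ʳ w c)) t-value)
Hyp-odd-split ([] ∷ʳ′ _)      _     _ () | refl , refl
Hyp-odd-split ((x ∷ w) ∷ʳ′ _) t-nlz _ _  | refl , refl =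
  (x ∷ w , NoLeadingZero-∷ʳ⁻¹ t-nlz , refl) , refl

append1-strictlySurjective : ∀ {m} → m ≥ 1 → (t : Hyp (2 * m + 1)) → ∃ λ w → append1 w ≡ t
append1-strictlySurjective m≥1 (t , t-nlz , t-value)
  with w , w∷ʳd1≡t ← Hyp-odd-split (initLast t) t-nlz t-value m≥1
  = w , Hyp-≡ w∷ʳd1≡t

proposition3p3 : (m : ℕ) → m ≥ 1 → GraphIso m (2 * m + 1)
proposition3p3 m m≥1 =
  append1
  , (append1-injective , strictlySurjective⇒surjective (append1-strictlySurjective m≥1))
  , λ u v → mk⇔ Child-∷ʳ-d1 Child-∷ʳ-d1⁻¹
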